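{- Let $p\ge 2$, let $G=K_{n_1,\dots,n_p}$ be the complete multipartite graph with part sizes $n_1,\dots,n_p$, and let $n=\sum_{i=1}^p n_i$. Then for every integer $m\ge 2$, $$SW_m(G)=\Big(\binom{n}{m}-\sum_{i=1}^p\binom{n_i}{m}\Big)(m-1)+\sum_{i=1}^p m\binom{n_i}{m}=(m-1)\binom{n}{m}+\sum_{i=1}^p\binom{n_i}{m}.$$ In particular the Wiener index of $G$ equals $\binom{n}{2}+\sum_{i=1}^p\binom{n_i}{2}$.
   Context: For a connected graph $X$, $d_X^m(S)$ is the number of edges of a smallest subtree of $X$ containing the vertex set $S$, $SW_m(X)=\sum_{S\subseteq V(X),|S|=m}d_X^m(S)$, and the Wiener index is $SW_2(X)$ (the sum of distances over unordered pairs of vertices). -}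

module Defs where

open import Data.Nat using (ℕ; zero; suc; _+_; _≤_; _≟_)
open import Data.Fin using (Fin; splitAt) renaming (zero to fzero; suc to fsuc)
open import Data.Fin.Subset using (Subset; inside; outside; _∈_; _⊆_; ∣_∣)
open import Data.Vec using (Vec; []; _∷_)
open import Data.List using (List; []; _∷_; _++_; map; length; filter)
open import Data.Nat.ListAction using (sum)
open import Data.List.Membership.Propositional renaming (_∈_ to _∈ₗ_)
open import Data.List.Relation.Unary.All using (All)
open import Data.List.Relation.Unary.AllPairs using (AllPairs)
open import Data.Product using (Σ; _×_; _,_)
open import Data.Sum using (_⊎_; inj₁; inj₂)
open import Relation.Binary.PropositionalEquality using (_≡_)
open import Relation.Nullary using (¬_)

Graph : ℕ → Set₁
Graph N = Fin N → Fin N → Set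

Edge : ℕ → Set
Edge N = Fin N × Fin N

SameEdge : ∀ {N} → Edge N → Edge N → Set
SameEdge (u , v) (u' , v') = (u ≡ u' × v ≡ v') ⊎ (u ≡ v' × v ≡ u')

data Reach {N : ℕ} (F : List (Edge N)) : Fin N → Fin N → Set where
  here : ∀ {u} → Reach F u u
  fwd  : ∀ {u v w} → (u , v) ∈ₗ F → Reach F v w → Reach F u w
  bwd  : ∀ {u v w} → (v , u) ∈ₗ F → Reach F v w → Reach F u w

-- A subtree of X: a subgraph (vertex set T, edge list F of distinct edges of X
-- with both ends in T) which is a tree, i.e. connected with |F| = |T| - 1.
record SubTree {N : ℕ} (X : Graph N) : Set where
  field
    verts     : Subset N
    edges     : List (Edge N)
    edgesOfX  : All (λ e → X (Data.Product.proj₁ e) (Data.Product.proj₂ e)) edges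
    endsInT   : All (λ e → Data.Product.proj₁ e ∈ verts × Data.Product.proj₂ e ∈ verts) edges
    distinct  : AllPairs (λ e e' → ¬ SameEdge e e') edges
    connected : ∀ u v → u ∈ verts → v ∈ verts → Reach edges u v
    treeCount : length edges + 1 ≡ ∣ verts ∣

open SubTree public

IsSteinerDist : ∀ {N} → Graph N → Subset N → ℕ → Set
IsSteinerDist X S k =
  Σ (SubTree X) (λ t → S ⊆ verts t × length (edges t) ≡ k)
  × (∀ (t : SubTree X) → S ⊆ verts t → k ≤ length (edges t))

allSubsets : (N : ℕ) → List (Subset N)
allSubsets zero = [] ∷ []
allSubsets (suc N) = map (inside ∷_) (allSubsets N) ++ map (outside ∷_) (allSubsets N)

sumOverSize : ∀ {N} → ℕ → (Subset N → ℕ) → ℕ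
sumOverSize {N} m f = sum (map f (filter (λ S → ∣ S ∣ ≟ m) (allSubsets N)))

IsSW : ∀ {N} → Graph N → ℕ → ℕ → Set
IsSW {N} X m w =
  Σ (Subset N → ℕ) (λ d →
    (∀ S → ∣ S ∣ ≡ m → IsSteinerDist X S (d S)) × sumOverSize m d ≡ w)

IsWiener : ∀ {N} → Graph N → ℕ → Set
IsWiener X w = IsSW X 2 w

-- complete multipartite graph K_{n_1,...,n_p}: vertices Fin (n_1 + ... + n_p),
-- consecutive blocks of sizes n_i; adjacent iff in different blocks
blockOf : ∀ {p} (ns : Vec ℕ p) → Fin (Data.Vec.sum ns) → Fin p
blockOf (n₀ ∷ ns) k with splitAt n₀ k
... | inj₁ _  = fzero
... | inj₂ k' = fsuc (blockOf ns k')

CompleteMultipartite : ∀ {p} (ns : Vec ℕ p) → Graph (Data.Vec.sum ns)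
CompleteMultipartite ns u v = ¬ (blockOf ns u ≡ blockOf ns v)

{-# OPTIONS --safe #-}
-- A set S of m ≥ 2 vertices of K_{n₁,…,nₚ} either meets two parts or lies inside one.
-- In the first case, with u, v ∈ S in different parts, hanging every other vertex of S
-- from u, or from v if it is in u's part, gives a tree on S itself, so d(S) = m − 1.
-- In the second case S is independent, so a tree containing S needs a further vertex,
-- and the star from a vertex of another part shows d(S) = m.  Hence
-- SW_m = (m − 1)·C(n,m) + #{m-sets inside a part} = (m − 1)·C(n,m) + Σᵢ C(nᵢ,m).
module Submission where

open import Defs
open import Algebra.Properties.CommutativeSemigroup using (interchange)
open import Data.Bool using (true; false; if_then_else_)
open import Data.Empty using (⊥-elim)
open import Data.Fin using (Fin; _↑ˡ_; _↑ʳ_) renaming (zero to fzero; suc to fsuc)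
open import Data.Fin.Properties using (splitAt-↑ˡ; splitAt-↑ʳ)
  renaming (_≟_ to _≟ᶠ_; 0≢1+n to fzero≢fsuc; suc-injective to fsuc-injective)
open import Data.Fin.Subset using (Subset; inside; outside; ∣_∣; Nonempty; _∈_; _∉_; _⊆_; _⊂_; _∪_; _∩_; ∁; ⁅_⁆)
open import Data.Fin.Subset.Properties
  using (x∈p∪q⁺; x∈p∪q⁻; x∈p∩q⁺; x∈p∩q⁻; x∉p⇒x∈∁p; x∈∁p⇒x∉p; x∈⁅x⁆; x∈⁅y⁆⇒x≡y; ∪-identityʳ; ⊆-antisym;
         p⊆q⇒∣p∣≤∣q∣; p⊂q⇒∣p∣<∣q∣; _∈?_)
open import Data.List as List using (List; []; _∷_; length)
open import Data.List.Properties using (map-++; map-∘; length-map)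
open import Data.List.Membership.Propositional using () renaming (_∈_ to _∈ₗ_)
open import Data.List.Membership.Propositional.Properties using (∈-map⁺; ∈-map⁻)
open import Data.List.Relation.Unary.Any using () renaming (here to hereₗ; there to thereₗ)
open import Data.List.Relation.Unary.All as All using (All; []; _∷_)
import Data.List.Relation.Unary.All.Properties as All
open import Data.List.Relation.Unary.AllPairs using (AllPairs; []; _∷_)
import Data.List.Relation.Unary.AllPairs.Properties as AllPairs
open import Data.List.Relation.Unary.Unique.Propositional using (Unique)
import Data.List.Relation.Unary.Unique.Propositional.Properties as Unique
open import Data.Nat using (ℕ; zero; suc; _+_; _*_; _∸_; _≤_; _≟_; z≤n; s≤s; s≤s⁻¹)
open import Data.Nat.Combinatorics using (_C_; nCk+nC[k+1]≡[n+1]C[k+1])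
open import Data.Nat.ListAction using () renaming (sum to sumₗ)
open import Data.Nat.ListAction.Properties using () renaming (sum-++ to sumₗ-++)
open import Data.Nat.Properties
open import Data.Product using (Σ; ∃; ∃₂; _×_; _,_; proj₁; proj₂)
open import Data.Sum using (_⊎_; inj₁; inj₂; [_,_]′)
open import Data.Vec using (Vec; []; _∷_; _++_; sum; map; lookup; take; drop)
open import Data.Vec.Base using (here; there)
open import Data.Vec.Properties using (take++drop≡id)
open import Function using (_∘_)
open import Relation.Nullary using (Dec; does; yes; no; ¬_)
open import Relation.Binary.PropositionalEquality

sumSubsets : (N : ℕ) → (Subset N → ℕ) → ℕ
sumSubsets zero    f = f []
sumSubsets (suc N) f = sumSubsets N (λ S → f (inside ∷ S)) + sumSubsets N (λ S → f (outside ∷ S))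

sumSubsets-cong : ∀ N {f g : Subset N → ℕ} → (∀ S → f S ≡ g S) → sumSubsets N f ≡ sumSubsets N g
sumSubsets-cong zero    f≗g = f≗g []
sumSubsets-cong (suc N) f≗g =
  cong₂ _+_ (sumSubsets-cong N (λ S → f≗g (inside ∷ S))) (sumSubsets-cong N (λ S → f≗g (outside ∷ S)))

sumSubsets-+ : ∀ N (f g : Subset N → ℕ) →
  sumSubsets N (λ S → f S + g S) ≡ sumSubsets N f + sumSubsets N g
sumSubsets-+ zero    f g = refl
sumSubsets-+ (suc N) f g =
  trans (cong₂ _+_ (sumSubsets-+ N (f ∘ (inside ∷_)) (g ∘ (inside ∷_)))
                   (sumSubsets-+ N (f ∘ (outside ∷_)) (g ∘ (outside ∷_))))
        (interchange +-commutativeSemigroup (sumSubsets N (f ∘ (inside ∷_))) (sumSubsets N (g ∘ (inside ∷_))) _ _)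

sumSubsets-*ˡ : ∀ N c (f : Subset N → ℕ) → sumSubsets N (λ S → c * f S) ≡ c * sumSubsets N f
sumSubsets-*ˡ zero    c f = refl
sumSubsets-*ˡ (suc N) c f =
  trans (cong₂ _+_ (sumSubsets-*ˡ N c (λ S → f (inside ∷ S))) (sumSubsets-*ˡ N c (λ S → f (outside ∷ S))))
        (sym (*-distribˡ-+ c _ _))

sumSubsets-≤ : ∀ N {f g : Subset N → ℕ} → (∀ S → f S ≤ g S) → sumSubsets N f ≤ sumSubsets N g
sumSubsets-≤ zero    f≤g = f≤g []
sumSubsets-≤ (suc N) f≤g =
  +-mono-≤ (sumSubsets-≤ N (λ S → f≤g (inside ∷ S))) (sumSubsets-≤ N (λ S → f≤g (outside ∷ S)))

sumSubsets-zero : ∀ N → sumSubsets N (λ _ → 0) ≡ 0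
sumSubsets-zero zero    = refl
sumSubsets-zero (suc N) = cong₂ _+_ (sumSubsets-zero N) (sumSubsets-zero N)

sumSubsets-++ : ∀ a b (f : Subset (a + b) → ℕ) →
  sumSubsets (a + b) f ≡ sumSubsets a (λ S₁ → sumSubsets b (λ S₂ → f (S₁ ++ S₂)))
sumSubsets-++ zero    b f = refl
sumSubsets-++ (suc a) b f =
  cong₂ _+_ (sumSubsets-++ a b (f ∘ (inside ∷_))) (sumSubsets-++ a b (f ∘ (outside ∷_)))

sumSubsets-product : ∀ a b (f : Subset a → ℕ) (g : Subset b → ℕ) →
  sumSubsets a (λ S₁ → sumSubsets b (λ S₂ → f S₁ * g S₂)) ≡ sumSubsets a f * sumSubsets b g
sumSubsets-product a b f g = begin
  sumSubsets a (λ S₁ → sumSubsets b (λ S₂ → f S₁ * g S₂)) ≡⟨ sumSubsets-cong a (λ S₁ → sumSubsets-*ˡ b (f S₁) g) ⟩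
  sumSubsets a (λ S₁ → f S₁ * sumSubsets b g)            ≡⟨ sumSubsets-cong a (λ S₁ → *-comm (f S₁) _) ⟩
  sumSubsets a (λ S₁ → sumSubsets b g * f S₁)            ≡⟨ sumSubsets-*ˡ a (sumSubsets b g) f ⟩
  sumSubsets b g * sumSubsets a f                        ≡⟨ *-comm _ (sumSubsets a f) ⟩
  sumSubsets a f * sumSubsets b g                        ∎
  where open ≡-Reasoning

sum-allSubsets : ∀ N (f : Subset N → ℕ) → sumₗ (List.map f (allSubsets N)) ≡ sumSubsets N f
sum-allSubsets zero    f = +-identityʳ (f [])
sum-allSubsets (suc N) f = begin
  sumₗ (List.map f (List.map (inside ∷_) A List.++ List.map (outside ∷_) A))
    ≡⟨ cong sumₗ (map-++ f (List.map (inside ∷_) A) _) ⟩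
  sumₗ (List.map f (List.map (inside ∷_) A) List.++ List.map f (List.map (outside ∷_) A))
    ≡⟨ sumₗ-++ (List.map f (List.map (inside ∷_) A)) _ ⟩
  sumₗ (List.map f (List.map (inside ∷_) A)) + sumₗ (List.map f (List.map (outside ∷_) A))
    ≡⟨ cong₂ _+_ (cong sumₗ (sym (map-∘ A))) (cong sumₗ (sym (map-∘ A))) ⟩
  sumₗ (List.map (λ S → f (inside ∷ S)) A) + sumₗ (List.map (λ S → f (outside ∷ S)) A)
    ≡⟨ cong₂ _+_ (sum-allSubsets N _) (sum-allSubsets N _) ⟩
  sumSubsets (suc N) f ∎
  where open ≡-Reasoning
        A = allSubsets N

sum-map-filter : ∀ {A : Set} {P : A → Set} (P? : ∀ x → Dec (P x)) (f : A → ℕ) xs →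
  sumₗ (List.map f (List.filter P? xs)) ≡ sumₗ (List.map (λ x → if does (P? x) then f x else 0) xs)
sum-map-filter P? f [] = refl
sum-map-filter P? f (x ∷ xs) with does (P? x)
... | true  = cong (f x +_) (sum-map-filter P? f xs)
... | false = sum-map-filter P? f xs

restrictToSize : ∀ {N} → ℕ → (Subset N → ℕ) → Subset N → ℕ
restrictToSize m f S = if does (∣ S ∣ ≟ m) then f S else 0

sumOverSize≡sumSubsets : ∀ N m (f : Subset N → ℕ) → sumOverSize m f ≡ sumSubsets N (restrictToSize m f)
sumOverSize≡sumSubsets N m f =
  trans (sum-map-filter (λ S → ∣ S ∣ ≟ m) f (allSubsets N)) (sum-allSubsets N _)

ofSize : ∀ {N} → ℕ → Subset N → ℕ
ofSize m = restrictToSize m (λ _ → 1)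

sumSubsets-ofSize : ∀ N m → sumSubsets N (ofSize m) ≡ N C m
sumSubsets-ofSize zero    zero    = refl
sumSubsets-ofSize zero    (suc m) = refl
sumSubsets-ofSize (suc N) zero    = cong₂ _+_ (sumSubsets-zero N) (sumSubsets-ofSize N zero)
sumSubsets-ofSize (suc N) (suc m) =
  trans (cong₂ _+_ (sumSubsets-ofSize N m) (sumSubsets-ofSize N (suc m))) (nCk+nC[k+1]≡[n+1]C[k+1] N m)

restrictToSize-+ : ∀ {N} m (f g : Subset N → ℕ) S →
  restrictToSize m (λ S → f S + g S) S ≡ restrictToSize m f S + restrictToSize m g S
restrictToSize-+ m f g S with does (∣ S ∣ ≟ m)
... | true  = refl
... | false = refl

restrictToSize-const : ∀ {N} m c (S : Subset N) → restrictToSize m (λ _ → c) S ≡ c * ofSize m S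
restrictToSize-const m c S with does (∣ S ∣ ≟ m)
... | true  = sym (*-identityʳ c)
... | false = sym (*-zeroʳ c)

restrictToSize-≤ : ∀ {N} m {f g : Subset N → ℕ} → (∀ S → f S ≤ g S) → ∀ S → restrictToSize m f S ≤ restrictToSize m g S
restrictToSize-≤ m f≤g S with does (∣ S ∣ ≟ m)
... | true  = f≤g S
... | false = z≤n

sumOverSize-+ : ∀ {N} m (f g : Subset N → ℕ) → sumOverSize m (λ S → f S + g S) ≡ sumOverSize m f + sumOverSize m g
sumOverSize-+ {N} m f g = begin
  sumOverSize m (λ S → f S + g S)
    ≡⟨ sumOverSize≡sumSubsets N m _ ⟩
  sumSubsets N (restrictToSize m (λ S → f S + g S))
    ≡⟨ sumSubsets-cong N (restrictToSize-+ m f g) ⟩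
  sumSubsets N (λ S → restrictToSize m f S + restrictToSize m g S)
    ≡⟨ sumSubsets-+ N _ _ ⟩
  sumSubsets N (restrictToSize m f) + sumSubsets N (restrictToSize m g)
    ≡⟨ sym (cong₂ _+_ (sumOverSize≡sumSubsets N m f) (sumOverSize≡sumSubsets N m g)) ⟩
  sumOverSize m f + sumOverSize m g ∎
  where open ≡-Reasoning

sumOverSize-const : ∀ N m c → sumOverSize {N} m (λ _ → c) ≡ c * (N C m)
sumOverSize-const N m c = begin
  sumOverSize {N} m (λ _ → c)                          ≡⟨ sumOverSize≡sumSubsets N m _ ⟩
  sumSubsets N (restrictToSize m (λ _ → c))            ≡⟨ sumSubsets-cong N (restrictToSize-const m c) ⟩
  sumSubsets N (λ S → c * ofSize m S)                   ≡⟨ sumSubsets-*ˡ N c _ ⟩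
  c * sumSubsets N (ofSize m)                           ≡⟨ cong (c *_) (sumSubsets-ofSize N m) ⟩
  c * (N C m)                                          ∎
  where open ≡-Reasoning

sumOverSize-≤ : ∀ {N} m {f g : Subset N → ℕ} → (∀ S → f S ≤ g S) → sumOverSize m f ≤ sumOverSize m g
sumOverSize-≤ {N} m {f} {g} f≤g =
  subst₂ _≤_ (sym (sumOverSize≡sumSubsets N m f)) (sym (sumOverSize≡sumSubsets N m g))
    (sumSubsets-≤ N (restrictToSize-≤ m f≤g))

take-++ : ∀ {A : Set} {a b} (xs : Vec A a) (ys : Vec A b) → take a (xs ++ ys) ≡ xs
take-++ []       ys = refl
take-++ (x ∷ xs) ys = cong (x ∷_) (take-++ xs ys)

drop-++ : ∀ {A : Set} {a b} (xs : Vec A a) (ys : Vec A b) → drop a (xs ++ ys) ≡ ys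
drop-++ []       ys = refl
drop-++ (x ∷ xs) ys = drop-++ xs ys

∣p++q∣≡∣p∣+∣q∣ : ∀ {a b} (p : Subset a) (q : Subset b) → ∣ p ++ q ∣ ≡ ∣ p ∣ + ∣ q ∣
∣p++q∣≡∣p∣+∣q∣ []            q = refl
∣p++q∣≡∣p∣+∣q∣ (inside ∷ p)  q = cong suc (∣p++q∣≡∣p∣+∣q∣ p q)
∣p++q∣≡∣p∣+∣q∣ (outside ∷ p) q = ∣p++q∣≡∣p∣+∣q∣ p q

∣p∣≡0⇒x∉p : ∀ {n} (p : Subset n) {x} → ∣ p ∣ ≡ 0 → x ∉ p
∣p∣≡0⇒x∉p (inside ∷ p)  ()  here
∣p∣≡0⇒x∉p (inside ∷ p)  ()  (there x∈p)
∣p∣≡0⇒x∉p (outside ∷ p) ∣p∣≡0 (there x∈p) = ∣p∣≡0⇒x∉p p ∣p∣≡0 x∈p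

∣p∣≢0⇒Nonempty : ∀ {n} (p : Subset n) → ¬ ∣ p ∣ ≡ 0 → Nonempty p
∣p∣≢0⇒Nonempty []            ∣p∣≢0 = ⊥-elim (∣p∣≢0 refl)
∣p∣≢0⇒Nonempty (inside ∷ p)  ∣p∣≢0 = fzero , here
∣p∣≢0⇒Nonempty (outside ∷ p) ∣p∣≢0 with ∣p∣≢0⇒Nonempty p ∣p∣≢0
... | x , x∈p = fsuc x , there x∈p

∈-++⁺ˡ : ∀ {a b} {p : Subset a} {q : Subset b} {i} → i ∈ p → (i ↑ˡ b) ∈ (p ++ q)
∈-++⁺ˡ here      = here
∈-++⁺ˡ (there i∈p) = there (∈-++⁺ˡ i∈p)

∈-++⁺ʳ : ∀ {a b} (p : Subset a) {q : Subset b} {k} → k ∈ q → (a ↑ʳ k) ∈ (p ++ q)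
∈-++⁺ʳ []      k∈q = k∈q
∈-++⁺ʳ (_ ∷ p) k∈q = there (∈-++⁺ʳ p k∈q)

∈-++⁻ : ∀ {a b} (p : Subset a) {q : Subset b} {x} → x ∈ (p ++ q) →
  (∃ λ i → i ∈ p × x ≡ i ↑ˡ b) ⊎ (∃ λ k → k ∈ q × x ≡ a ↑ʳ k)
∈-++⁻ []      x∈q = inj₂ (_ , x∈q , refl)
∈-++⁻ (_ ∷ p) here = inj₁ (fzero , here , refl)
∈-++⁻ (_ ∷ p) (there x∈p++q) with ∈-++⁻ p x∈p++q
... | inj₁ (i , i∈p , refl) = inj₁ (fsuc i , there i∈p , refl)
... | inj₂ (k , k∈q , refl) = inj₂ (k , k∈q , refl)

module _ {p} (n : ℕ) (ns : Vec ℕ p) where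

  blockOf-↑ˡ : ∀ i → blockOf (n ∷ ns) (i ↑ˡ sum ns) ≡ fzero
  blockOf-↑ˡ i rewrite splitAt-↑ˡ n i (sum ns) = refl

  blockOf-↑ʳ : ∀ k → blockOf (n ∷ ns) (n ↑ʳ k) ≡ fsuc (blockOf ns k)
  blockOf-↑ʳ k rewrite splitAt-↑ʳ n (sum ns) k = refl

  blockOf-∈-++ : ∀ {S₁ : Subset n} {S₂ : Subset (sum ns)} {x} → x ∈ (S₁ ++ S₂) →
    (Nonempty S₁ × blockOf (n ∷ ns) x ≡ fzero) ⊎ (∃ λ k → k ∈ S₂ × blockOf (n ∷ ns) x ≡ fsuc (blockOf ns k))
  blockOf-∈-++ {S₁} x∈S with ∈-++⁻ S₁ x∈S
  ... | inj₁ (i , i∈S₁ , refl) = inj₁ ((i , i∈S₁) , blockOf-↑ˡ i)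
  ... | inj₂ (k , k∈S₂ , refl) = inj₂ (k , k∈S₂ , blockOf-↑ʳ k)

extendMonochromatic : ∀ {P Q : Set} → Dec P → Dec Q → ℕ → ℕ
extendMonochromatic (yes _) (yes _) _ = 0
extendMonochromatic (no _)  (yes _) _ = 1
extendMonochromatic (yes _) (no _)  r = r
extendMonochromatic (no _)  (no _)  _ = 0

-- 1 if S is nonempty and lies inside a single part of the partition ns, 0 otherwise
monochromatic : ∀ {p} (ns : Vec ℕ p) → Subset (sum ns) → ℕ
monochromatic []       S = 0
monochromatic (n ∷ ns) S =
  extendMonochromatic (∣ take n S ∣ ≟ 0) (∣ drop n S ∣ ≟ 0) (monochromatic ns (drop n S))

monochromatic≤1 : ∀ {p} (ns : Vec ℕ p) S → monochromatic ns S ≤ 1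
monochromatic≤1 []       S = z≤n
monochromatic≤1 (n ∷ ns) S = extend≤1 (∣ take n S ∣ ≟ 0) (∣ drop n S ∣ ≟ 0)
  where
  extend≤1 : ∀ {P Q : Set} (d₁ : Dec P) (d₂ : Dec Q) → extendMonochromatic d₁ d₂ (monochromatic ns (drop n S)) ≤ 1
  extend≤1 (yes _) (yes _) = z≤n
  extend≤1 (no _)  (yes _) = s≤s z≤n
  extend≤1 (yes _) (no _)  = monochromatic≤1 ns (drop n S)
  extend≤1 (no _)  (no _)  = z≤n

restrictToSize-extendMonochromatic : ∀ a b m r →
  (if does (a + b ≟ suc m) then extendMonochromatic (a ≟ 0) (b ≟ 0) r else 0)
  ≡ (if does (a ≟ suc m) then 1 else 0) * (if does (b ≟ 0) then 1 else 0)
    + (if does (a ≟ 0) then 1 else 0) * (if does (b ≟ suc m) then r else 0)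
restrictToSize-extendMonochromatic zero    zero    m r = refl
restrictToSize-extendMonochromatic (suc a) zero    m r rewrite +-identityʳ a =
  sym (trans (+-identityʳ _) (*-identityʳ _))
restrictToSize-extendMonochromatic zero    (suc b) m r = sym (+-identityʳ _)
restrictToSize-extendMonochromatic (suc a) (suc b) m r
  with does (a + suc b ≟ m) | does (a ≟ m)
... | true  | true  = refl
... | true  | false = refl
... | false | true  = refl
... | false | false = refl

sumSubsets-monochromatic : ∀ {p} (ns : Vec ℕ p) m →
  sumSubsets (sum ns) (restrictToSize (suc m) (monochromatic ns)) ≡ sum (map (_C suc m) ns)
sumSubsets-monochromatic []       m = refl
sumSubsets-monochromatic (n ∷ ns) m = begin
  sumSubsets (n + N) (restrictToSize (suc m) (monochromatic (n ∷ ns)))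
    ≡⟨ sumSubsets-++ n N _ ⟩
  sumSubsets n (λ S₁ → sumSubsets N (λ S₂ → restrictToSize (suc m) (monochromatic (n ∷ ns)) (S₁ ++ S₂)))
    ≡⟨ sumSubsets-cong n (λ S₁ → sumSubsets-cong N (split S₁)) ⟩
  sumSubsets n (λ S₁ → sumSubsets N (λ S₂ → ofSize (suc m) S₁ * ofSize 0 S₂ + ofSize 0 S₁ * rest S₂))
    ≡⟨ sumSubsets-cong n (λ S₁ → sumSubsets-+ N _ _) ⟩
  sumSubsets n (λ S₁ → sumSubsets N (λ S₂ → ofSize (suc m) S₁ * ofSize 0 S₂)
                       + sumSubsets N (λ S₂ → ofSize 0 S₁ * rest S₂))
    ≡⟨ sumSubsets-+ n _ _ ⟩
  sumSubsets n (λ S₁ → sumSubsets N (λ S₂ → ofSize (suc m) S₁ * ofSize 0 S₂))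
  + sumSubsets n (λ S₁ → sumSubsets N (λ S₂ → ofSize 0 S₁ * rest S₂))
    ≡⟨ cong₂ _+_ (sumSubsets-product n N _ _) (sumSubsets-product n N _ _) ⟩
  sumSubsets n (ofSize (suc m)) * sumSubsets N (ofSize 0) + sumSubsets n (ofSize 0) * sumSubsets N rest
    ≡⟨ cong₂ _+_ (cong₂ _*_ (sumSubsets-ofSize n (suc m)) (sumSubsets-ofSize N 0))
                 (cong₂ _*_ (sumSubsets-ofSize n 0) (sumSubsets-monochromatic ns m)) ⟩
  (n C suc m) * 1 + 1 * sum (map (_C suc m) ns)
    ≡⟨ cong₂ _+_ (*-identityʳ (n C suc m)) (*-identityˡ _) ⟩
  sum (map (_C suc m) (n ∷ ns)) ∎
  where
  open ≡-Reasoning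
  N = sum ns
  rest = restrictToSize (suc m) (monochromatic ns)
  split : ∀ S₁ S₂ → restrictToSize (suc m) (monochromatic (n ∷ ns)) (S₁ ++ S₂)
                    ≡ ofSize (suc m) S₁ * ofSize 0 S₂ + ofSize 0 S₁ * rest S₂
  split S₁ S₂ rewrite take-++ S₁ S₂ | drop-++ S₁ S₂ | ∣p++q∣≡∣p∣+∣q∣ S₁ S₂ =
    restrictToSize-extendMonochromatic ∣ S₁ ∣ ∣ S₂ ∣ m (monochromatic ns S₂)

sumOverSize-monochromatic : ∀ {p} (ns : Vec ℕ p) m →
  sumOverSize (suc m) (monochromatic ns) ≡ sum (map (_C suc m) ns)
sumOverSize-monochromatic ns m =
  trans (sumOverSize≡sumSubsets (sum ns) (suc m) _) (sumSubsets-monochromatic ns m)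

sum-C≤C-sum : ∀ {p} (ns : Vec ℕ p) m → sum (map (_C suc m) ns) ≤ sum ns C suc m
sum-C≤C-sum ns m = subst₂ _≤_ (sumOverSize-monochromatic ns m)
  (trans (sumOverSize-const (sum ns) (suc m) 1) (*-identityˡ _))
  (sumOverSize-≤ (suc m) (monochromatic≤1 ns))

monochromatic⇒sameBlock : ∀ {p} (ns : Vec ℕ p) S → monochromatic ns S ≡ 1 →
  ∀ {x y} → x ∈ S → y ∈ S → blockOf ns x ≡ blockOf ns y
monochromatic⇒sameBlock []       S ()
monochromatic⇒sameBlock (n ∷ ns) S mono {x} {y} x∈S y∈S =
  cases (∣ take n S ∣ ≟ 0) (∣ drop n S ∣ ≟ 0) mono (resplit x∈S) (resplit y∈S)
  where
  resplit : ∀ {z} → z ∈ S → z ∈ (take n S ++ drop n S)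
  resplit = subst (_ ∈_) (sym (take++drop≡id n S))
  cases : ∀ {S₁ S₂} (d₁ : Dec (∣ S₁ ∣ ≡ 0)) (d₂ : Dec (∣ S₂ ∣ ≡ 0)) →
    extendMonochromatic d₁ d₂ (monochromatic ns S₂) ≡ 1 →
    x ∈ (S₁ ++ S₂) → y ∈ (S₁ ++ S₂) → blockOf (n ∷ ns) x ≡ blockOf (n ∷ ns) y
  cases {S₁} {S₂} (no _) (yes ∣S₂∣≡0) _ x∈ y∈ with blockOf-∈-++ n ns x∈ | blockOf-∈-++ n ns y∈
  ... | inj₁ (_ , bx) | inj₁ (_ , by) = trans bx (sym by)
  ... | inj₂ (_ , k∈S₂ , _) | _ = ⊥-elim (∣p∣≡0⇒x∉p S₂ ∣S₂∣≡0 k∈S₂)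
  ... | _ | inj₂ (_ , k∈S₂ , _) = ⊥-elim (∣p∣≡0⇒x∉p S₂ ∣S₂∣≡0 k∈S₂)
  cases {S₁} {S₂} (yes ∣S₁∣≡0) (no _) mono′ x∈ y∈ with blockOf-∈-++ n ns x∈ | blockOf-∈-++ n ns y∈
  ... | inj₁ ((_ , i∈S₁) , _) | _ = ⊥-elim (∣p∣≡0⇒x∉p S₁ ∣S₁∣≡0 i∈S₁)
  ... | _ | inj₁ ((_ , i∈S₁) , _) = ⊥-elim (∣p∣≡0⇒x∉p S₁ ∣S₁∣≡0 i∈S₁)
  ... | inj₂ (k , k∈S₂ , bx) | inj₂ (k′ , k′∈S₂ , by) =
    trans bx (trans (cong fsuc (monochromatic⇒sameBlock ns S₂ mono′ k∈S₂ k′∈S₂)) (sym by))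
  cases (yes _) (yes _) () _ _
  cases (no _)  (no _)  () _ _

monochromatic≡0⇒twoBlocks : ∀ {p} (ns : Vec ℕ p) S → monochromatic ns S ≡ 0 → ¬ ∣ S ∣ ≡ 0 →
  ∃₂ λ u v → u ∈ S × v ∈ S × ¬ blockOf ns u ≡ blockOf ns v
monochromatic≡0⇒twoBlocks []       [] _ ∣S∣≢0 = ⊥-elim (∣S∣≢0 refl)
monochromatic≡0⇒twoBlocks (n ∷ ns) S nonMono ∣S∣≢0
  with cases (∣ take n S ∣ ≟ 0) (∣ drop n S ∣ ≟ 0) nonMono
              (λ ∣S∣≡0 → ∣S∣≢0 (trans (cong ∣_∣ (sym (take++drop≡id n S))) ∣S∣≡0))
  where
  cases : ∀ {S₁ S₂} (d₁ : Dec (∣ S₁ ∣ ≡ 0)) (d₂ : Dec (∣ S₂ ∣ ≡ 0)) →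
    extendMonochromatic d₁ d₂ (monochromatic ns S₂) ≡ 0 → ¬ ∣ S₁ ++ S₂ ∣ ≡ 0 →
    ∃₂ λ u v → u ∈ (S₁ ++ S₂) × v ∈ (S₁ ++ S₂) × ¬ blockOf (n ∷ ns) u ≡ blockOf (n ∷ ns) v
  cases {S₁} {S₂} (yes ∣S₁∣≡0) (yes ∣S₂∣≡0) _ ∣S∣≢0 =
    ⊥-elim (∣S∣≢0 (trans (∣p++q∣≡∣p∣+∣q∣ S₁ S₂) (cong₂ _+_ ∣S₁∣≡0 ∣S₂∣≡0)))
  cases (no _) (yes _) () _
  cases {S₁} {S₂} (yes _) (no ∣S₂∣≢0) nonMono′ _ with monochromatic≡0⇒twoBlocks ns S₂ nonMono′ ∣S₂∣≢0
  ... | u , v , u∈S₂ , v∈S₂ , bu≢bv =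
    n ↑ʳ u , n ↑ʳ v , ∈-++⁺ʳ S₁ u∈S₂ , ∈-++⁺ʳ S₁ v∈S₂ ,
    λ e → bu≢bv (fsuc-injective (trans (sym (blockOf-↑ʳ n ns u)) (trans e (blockOf-↑ʳ n ns v))))
  cases {S₁} {S₂} (no ∣S₁∣≢0) (no ∣S₂∣≢0) _ _
    with ∣p∣≢0⇒Nonempty S₁ ∣S₁∣≢0 | ∣p∣≢0⇒Nonempty S₂ ∣S₂∣≢0
  ... | i , i∈S₁ | k , k∈S₂ =
    i ↑ˡ sum ns , n ↑ʳ k , ∈-++⁺ˡ i∈S₁ , ∈-++⁺ʳ S₁ k∈S₂ ,
    λ e → fzero≢fsuc (trans (sym (blockOf-↑ˡ n ns i)) (trans e (blockOf-↑ʳ n ns k)))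
... | u , v , u∈ , v∈ , bu≢bv = u , v , unsplit u∈ , unsplit v∈ , bu≢bv
  where
  unsplit : ∀ {z} → z ∈ (take n S ++ drop n S) → z ∈ S
  unsplit = subst (_ ∈_) (take++drop≡id n S)

elements : ∀ {N} → Subset N → List (Fin N)
elements []            = []
elements (inside ∷ p)  = fzero ∷ List.map fsuc (elements p)
elements (outside ∷ p) = List.map fsuc (elements p)

∈-elements⁺ : ∀ {N} (p : Subset N) {x} → x ∈ p → x ∈ₗ elements p
∈-elements⁺ (inside ∷ p)  here        = hereₗ refl
∈-elements⁺ (inside ∷ p)  (there x∈p) = thereₗ (∈-map⁺ fsuc (∈-elements⁺ p x∈p))
∈-elements⁺ (outside ∷ p) (there x∈p) = ∈-map⁺ fsuc (∈-elements⁺ p x∈p)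

∈-elements⁻ : ∀ {N} (p : Subset N) {x} → x ∈ₗ elements p → x ∈ p
∈-elements⁻ (inside ∷ p) (hereₗ refl) = here
∈-elements⁻ (inside ∷ p) (thereₗ x∈) with ∈-map⁻ fsuc x∈
... | _ , y∈ , refl = there (∈-elements⁻ p y∈)
∈-elements⁻ (outside ∷ p) x∈ with ∈-map⁻ fsuc x∈
... | _ , y∈ , refl = there (∈-elements⁻ p y∈)

length-elements : ∀ {N} (p : Subset N) → length (elements p) ≡ ∣ p ∣
length-elements []            = refl
length-elements (inside ∷ p)  = cong suc (trans (length-map fsuc (elements p)) (length-elements p))
length-elements (outside ∷ p) = trans (length-map fsuc (elements p)) (length-elements p)

elements-unique : ∀ {N} (p : Subset N) → Unique (elements p)
elements-unique []            = []
elements-unique (inside ∷ p)  =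
  All.map⁺ (All.tabulate (λ _ ())) ∷ Unique.map⁺ fsuc-injective (elements-unique p)
elements-unique (outside ∷ p) = Unique.map⁺ fsuc-injective (elements-unique p)

∣p∪⁅x⁆∣≡1+∣p∣ : ∀ {N} (p : Subset N) {x} → x ∉ p → ∣ p ∪ ⁅ x ⁆ ∣ ≡ suc ∣ p ∣
∣p∪⁅x⁆∣≡1+∣p∣ (inside ∷ p)  {fzero}  x∉p = ⊥-elim (x∉p here)
∣p∪⁅x⁆∣≡1+∣p∣ (outside ∷ p) {fzero}  x∉p = cong (λ q → suc ∣ q ∣) (∪-identityʳ p)
∣p∪⁅x⁆∣≡1+∣p∣ (inside ∷ p)  {fsuc x} x∉p = cong suc (∣p∪⁅x⁆∣≡1+∣p∣ p (x∉p ∘ there))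
∣p∪⁅x⁆∣≡1+∣p∣ (outside ∷ p) {fsuc x} x∉p = ∣p∪⁅x⁆∣≡1+∣p∣ p (x∉p ∘ there)

Unique⇒AllPairs : ∀ {A : Set} {P : A → Set} {R : A → A → Set} →
  (∀ {x y} → P x → P y → ¬ x ≡ y → R x y) → ∀ {xs} → Unique xs → All P xs → AllPairs R xs
Unique⇒AllPairs r []            []         = []
Unique⇒AllPairs r (x∉xs ∷ uniq) (px ∷ pxs) =
  All.zipWith (λ (x≢y , py) → r px py x≢y) (x∉xs , pxs) ∷ Unique⇒AllPairs r uniq pxs

Reach-trans : ∀ {N} {F : List (Edge N)} {u v w} → Reach F u v → Reach F v w → Reach F u w
Reach-trans here          v↝w = v↝w
Reach-trans (fwd e u↝v)   v↝w = fwd e (Reach-trans u↝v v↝w)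
Reach-trans (bwd e u↝v)   v↝w = bwd e (Reach-trans u↝v v↝w)

Reach-sym : ∀ {N} {F : List (Edge N)} {u v} → Reach F u v → Reach F v u
Reach-sym here        = here
Reach-sym (fwd e u↝v) = Reach-trans (Reach-sym u↝v) (bwd e here)
Reach-sym (bwd e u↝v) = Reach-trans (Reach-sym u↝v) (fwd e here)

doubleStar : ∀ {N} (X : Graph N) (R : Subset N) (r v : Fin N) (parent : Fin N → Fin N) → r ∉ R →
  (∀ {x} → x ∈ R → parent x ≡ r ⊎ parent x ≡ v) → v ≡ r ⊎ (v ∈ R × parent v ≡ r) →
  (∀ {x} → x ∈ R → X (parent x) x) →
  Σ (SubTree X) λ t → verts t ≡ R ∪ ⁅ r ⁆ × length (edges t) ≡ ∣ R ∣
doubleStar {N} X R r v parent r∉R parent∈rv v-parent X-parent = tree , refl , length-E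
  where
  edgeTo : Fin N → Edge N
  edgeTo x = parent x , x
  E = List.map edgeTo (elements R)
  T = R ∪ ⁅ r ⁆

  length-E : length E ≡ ∣ R ∣
  length-E = trans (length-map edgeTo (elements R)) (length-elements R)

  edgeTo∈E : ∀ {x} → x ∈ R → edgeTo x ∈ₗ E
  edgeTo∈E x∈R = ∈-map⁺ edgeTo (∈-elements⁺ R x∈R)

  ≡r∈T : ∀ {x} → x ≡ r → x ∈ T
  ≡r∈T refl = x∈p∪q⁺ (inj₂ (x∈⁅x⁆ r))

  v∈T : v ∈ T
  v∈T = [ ≡r∈T , (λ (v∈R , _) → x∈p∪q⁺ (inj₁ v∈R)) ]′ v-parent

  parent∈T : ∀ {x} → x ∈ R → parent x ∈ T
  parent∈T x∈R = [ ≡r∈T , (λ p≡v → subst (_∈ T) (sym p≡v) v∈T) ]′ (parent∈rv x∈R)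

  ≡r↝r : ∀ {x} → x ≡ r → Reach E x r
  ≡r↝r refl = here

  v↝r : Reach E v r
  v↝r = [ ≡r↝r , (λ (v∈R , p≡r) → bwd (edgeTo∈E v∈R) (≡r↝r p≡r)) ]′ v-parent

  parent↝r : ∀ {x} → x ∈ R → Reach E (parent x) r
  parent↝r x∈R = [ ≡r↝r , (λ p≡v → subst (λ y → Reach E y r) (sym p≡v) v↝r) ]′ (parent∈rv x∈R)

  ↝r : ∀ {x} → x ∈ T → Reach E x r
  ↝r {x} x∈T with x∈p∪q⁻ R ⁅ r ⁆ x∈T
  ... | inj₁ x∈R   = bwd (edgeTo∈E x∈R) (parent↝r x∈R)
  ... | inj₂ x∈⁅r⁆ = ≡r↝r (x∈⁅y⁆⇒x≡y r x∈⁅r⁆)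

  -- a reversed pair of edges would make x and y each other's parent, hence both v
  distinctEdges : ∀ {x y} → x ∈ R → y ∈ R → ¬ x ≡ y → ¬ SameEdge (edgeTo x) (edgeTo y)
  distinctEdges _ _ x≢y (inj₁ (_ , x≡y)) = x≢y x≡y
  distinctEdges x∈R y∈R x≢y (inj₂ (px≡y , x≡py)) with parent∈rv x∈R | parent∈rv y∈R
  ... | inj₁ px≡r | _         = r∉R (subst (_∈ R) (trans (sym px≡y) px≡r) y∈R)
  ... | _         | inj₁ py≡r = r∉R (subst (_∈ R) (trans x≡py py≡r) x∈R)
  ... | inj₂ px≡v | inj₂ py≡v = x≢y (trans x≡py (trans py≡v (trans (sym px≡v) px≡y)))

  tree : SubTree X
  tree = record
    { verts     = T
    ; edges     = E
    ; edgesOfX  = All.map⁺ (All.tabulate (λ x∈ → X-parent (∈-elements⁻ R x∈)))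
    ; endsInT   = All.map⁺ (All.tabulate (λ x∈ →
                    parent∈T (∈-elements⁻ R x∈) , x∈p∪q⁺ (inj₁ (∈-elements⁻ R x∈))))
    ; distinct  = AllPairs.map⁺ (Unique⇒AllPairs distinctEdges (elements-unique R)
                                   (All.tabulate (∈-elements⁻ R)))
    ; connected = λ x y x∈T y∈T → Reach-trans (↝r x∈T) (Reach-sym (↝r y∈T))
    ; treeCount = trans (cong (_+ 1) length-E) (trans (+-comm ∣ R ∣ 1) (sym (∣p∪⁅x⁆∣≡1+∣p∣ R r∉R)))
    }

∣verts∣≡1+∣edges∣ : ∀ {N} {X : Graph N} (t : SubTree X) → ∣ verts t ∣ ≡ suc (length (edges t))
∣verts∣≡1+∣edges∣ t = trans (sym (treeCount t)) (+-comm (length (edges t)) 1)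

∣S∣≤1+∣edges∣ : ∀ {N} {X : Graph N} (t : SubTree X) {S} → S ⊆ verts t → ∣ S ∣ ≤ suc (length (edges t))
∣S∣≤1+∣edges∣ t S⊆T = subst (_ ≤_) (∣verts∣≡1+∣edges∣ t) (p⊆q⇒∣p∣≤∣q∣ S⊆T)

independent⊂subtree : ∀ {N} {X : Graph N} (t : SubTree X) {S} →
  (∀ {x y} → x ∈ S → y ∈ S → ¬ X x y) → 2 ≤ ∣ S ∣ → S ⊆ verts t → S ⊂ verts t
independent⊂subtree {X = X} t {S} independent 2≤∣S∣ S⊆T =
  S⊆T , leaving (edges t) (edgesOfX t) (endsInT t) edges-nonempty
  where
  edges-nonempty : 1 ≤ length (edges t)
  edges-nonempty = s≤s⁻¹ (≤-trans 2≤∣S∣ (∣S∣≤1+∣edges∣ t S⊆T))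
  leaving : ∀ E → All (λ (a , b) → X a b) E → All (λ (a , b) → a ∈ verts t × b ∈ verts t) E →
    1 ≤ length E → ∃ λ z → z ∈ verts t × z ∉ S
  leaving ((a , b) ∷ _) (Xab ∷ _) ((a∈T , b∈T) ∷ _) _ with a ∈? S | b ∈? S
  ... | yes a∈S | yes b∈S = ⊥-elim (independent a∈S b∈S Xab)
  ... | no a∉S  | _       = a , a∈T , a∉S
  ... | yes _   | no b∉S  = b , b∈T , b∉S

vertexInOtherPart : ∀ {p} (ns : Vec ℕ (suc (suc p))) → (∀ i → 1 ≤ lookup ns i) →
  ∀ x → ∃ λ y → ¬ blockOf ns y ≡ blockOf ns x
vertexInOtherPart (zero ∷ _)  nonempty x with nonempty fzero
... | ()
vertexInOtherPart (suc a ∷ zero ∷ _) nonempty x with nonempty (fsuc fzero)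
... | ()
vertexInOtherPart (suc a ∷ suc b ∷ ns) _ x with blockOf (suc a ∷ suc b ∷ ns) x ≟ᶠ fzero
... | yes bx≡0 = suc a ↑ʳ fzero ,
      λ by≡bx → fzero≢fsuc (trans (sym bx≡0) (trans (sym by≡bx) (blockOf-↑ʳ (suc a) (suc b ∷ ns) fzero)))
... | no  bx≢0 = fzero , λ by≡bx → bx≢0 (sym by≡bx)

module _ {p} (ns : Vec ℕ (suc (suc p))) (parts-nonempty : ∀ i → 1 ≤ lookup ns i) where

  private
    X = CompleteMultipartite ns
    N = sum ns

  isSteinerDist-monochromatic : ∀ S → 2 ≤ ∣ S ∣ → monochromatic ns S ≡ 1 → IsSteinerDist X S ∣ S ∣
  isSteinerDist-monochromatic S 2≤∣S∣ mono with ∣p∣≢0⇒Nonempty S (m<n⇒n≢0 2≤∣S∣)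
  ... | x₀ , x₀∈S with vertexInOtherPart ns parts-nonempty x₀
  ... | c , c-other = (proj₁ star , S⊆T , proj₂ (proj₂ star)) , lower
    where
    sameBlock : ∀ {x y} → x ∈ S → y ∈ S → blockOf ns x ≡ blockOf ns y
    sameBlock = monochromatic⇒sameBlock ns S mono
    c∉S : c ∉ S
    c∉S c∈S = c-other (sameBlock c∈S x₀∈S)
    star = doubleStar X S c c (λ _ → c) c∉S (λ _ → inj₁ refl) (inj₁ refl)
             (λ x∈S bc≡bx → c-other (trans bc≡bx (sameBlock x∈S x₀∈S)))
    S⊆T : S ⊆ verts (proj₁ star)
    S⊆T x∈S = subst (_ ∈_) (sym (proj₁ (proj₂ star))) (x∈p∪q⁺ (inj₁ x∈S))
    lower : ∀ t → S ⊆ verts t → ∣ S ∣ ≤ length (edges t)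
    lower t S⊆T′ = s≤s⁻¹ (subst (suc ∣ S ∣ ≤_) (∣verts∣≡1+∣edges∣ t)
      (p⊂q⇒∣p∣<∣q∣ (independent⊂subtree t (λ x∈S y∈S Xxy → Xxy (sameBlock x∈S y∈S)) 2≤∣S∣ S⊆T′)))

  isSteinerDist-nonMonochromatic : ∀ S → 2 ≤ ∣ S ∣ → monochromatic ns S ≡ 0 → IsSteinerDist X S (∣ S ∣ ∸ 1)
  isSteinerDist-nonMonochromatic S 2≤∣S∣ nonMono with monochromatic≡0⇒twoBlocks ns S nonMono (m<n⇒n≢0 2≤∣S∣)
  ... | u , v , u∈S , v∈S , bu≢bv = (tree , S⊆T , length-edges) , lower
    where
    R = S ∩ ∁ ⁅ u ⁆

    ∈R⁺ : ∀ {x} → x ∈ S → ¬ x ≡ u → x ∈ R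
    ∈R⁺ x∈S x≢u = x∈p∩q⁺ (x∈S , x∉p⇒x∈∁p (x≢u ∘ x∈⁅y⁆⇒x≡y u))

    u∉R : u ∉ R
    u∉R u∈R = x∈∁p⇒x∉p (proj₂ (x∈p∩q⁻ S _ u∈R)) (x∈⁅x⁆ u)

    parent : Fin N → Fin N
    parent x with blockOf ns x ≟ᶠ blockOf ns u
    ... | yes _ = v
    ... | no  _ = u

    parent-spec : ∀ x → (blockOf ns x ≡ blockOf ns u × parent x ≡ v)
                      ⊎ (¬ blockOf ns x ≡ blockOf ns u × parent x ≡ u)
    parent-spec x with blockOf ns x ≟ᶠ blockOf ns u
    ... | yes bx≡bu = inj₁ (bx≡bu , refl)
    ... | no  bx≢bu = inj₂ (bx≢bu , refl)

    parent∈uv : ∀ {x} → x ∈ R → parent x ≡ u ⊎ parent x ≡ v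
    parent∈uv {x} _ = [ inj₂ ∘ proj₂ , inj₁ ∘ proj₂ ]′ (parent-spec x)

    parent-v : parent v ≡ u
    parent-v = [ (λ (bv≡bu , _) → ⊥-elim (bu≢bv (sym bv≡bu))) , proj₂ ]′ (parent-spec v)

    X-parent : ∀ {x} → x ∈ R → X (parent x) x
    X-parent {x} _ with parent-spec x
    ... | inj₁ (bx≡bu , px≡v) =
      λ bp≡bx → bu≢bv (sym (trans (trans (cong (blockOf ns) (sym px≡v)) bp≡bx) bx≡bu))
    ... | inj₂ (bx≢bu , px≡u) = λ bp≡bx → bx≢bu (sym (trans (cong (blockOf ns) (sym px≡u)) bp≡bx))

    star = doubleStar X R u v parent u∉R parent∈uv
             (inj₂ (∈R⁺ v∈S (λ v≡u → bu≢bv (sym (cong (blockOf ns) v≡u))) , parent-v)) X-parent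
    tree = proj₁ star

    verts≡S : verts tree ≡ S
    verts≡S = trans (proj₁ (proj₂ star)) (⊆-antisym R∪u⊆S S⊆R∪u)
      where
      R∪u⊆S : R ∪ ⁅ u ⁆ ⊆ S
      R∪u⊆S x∈ = [ proj₁ ∘ x∈p∩q⁻ S _ , (λ x∈⁅u⁆ → subst (_∈ S) (sym (x∈⁅y⁆⇒x≡y u x∈⁅u⁆)) u∈S) ]′
                   (x∈p∪q⁻ R ⁅ u ⁆ x∈)
      S⊆R∪u : S ⊆ R ∪ ⁅ u ⁆
      S⊆R∪u {x} x∈S with x ≟ᶠ u
      ... | yes refl = x∈p∪q⁺ (inj₂ (x∈⁅x⁆ u))
      ... | no  x≢u  = x∈p∪q⁺ (inj₁ (∈R⁺ x∈S x≢u))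

    S⊆T : S ⊆ verts tree
    S⊆T = subst (S ⊆_) (sym verts≡S) (λ x∈S → x∈S)

    length-edges : length (edges tree) ≡ ∣ S ∣ ∸ 1
    length-edges = sym (cong (_∸ 1) (trans (cong ∣_∣ (sym verts≡S)) (∣verts∣≡1+∣edges∣ tree)))

    lower : ∀ t → S ⊆ verts t → ∣ S ∣ ∸ 1 ≤ length (edges t)
    lower t S⊆T′ = m≤n+o⇒m∸n≤o ∣ S ∣ 1 (∣S∣≤1+∣edges∣ t S⊆T′)

  isSteinerDist-completeMultipartite : ∀ S → 2 ≤ ∣ S ∣ → IsSteinerDist X S (∣ S ∣ ∸ 1 + monochromatic ns S)
  isSteinerDist-completeMultipartite S 2≤∣S∣ with monochromatic ns S in mono | monochromatic≤1 ns S
  ... | 0           | _ =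
    subst (IsSteinerDist X S) (sym (+-identityʳ _)) (isSteinerDist-nonMonochromatic S 2≤∣S∣ mono)
  ... | 1           | _ =
    subst (IsSteinerDist X S) (sym (m∸n+n≡m (≤-trans (s≤s z≤n) 2≤∣S∣))) (isSteinerDist-monochromatic S 2≤∣S∣ mono)
  ... | suc (suc _) | s≤s ()

  isSW-completeMultipartite : ∀ m → 2 ≤ m → IsSW X m ((m ∸ 1) * (N C m) + sum (map (_C m) ns))
  isSW-completeMultipartite m@(suc m′) 2≤m = (λ S → m′ + monochromatic ns S) , steinerDists , total
    where
    steinerDists : ∀ S → ∣ S ∣ ≡ m → IsSteinerDist X S (m′ + monochromatic ns S)
    steinerDists S ∣S∣≡m = subst (λ k → IsSteinerDist X S (k ∸ 1 + monochromatic ns S)) ∣S∣≡m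
                             (isSteinerDist-completeMultipartite S (subst (2 ≤_) (sym ∣S∣≡m) 2≤m))
    total : sumOverSize m (λ S → m′ + monochromatic ns S) ≡ m′ * (N C m) + sum (map (_C m) ns)
    total = trans (sumOverSize-+ m (λ _ → m′) (monochromatic ns))
                  (cong₂ _+_ (sumOverSize-const N m m′) (sumOverSize-monochromatic ns m′))

sum-map-*ˡ : ∀ {p} c (f : ℕ → ℕ) (ns : Vec ℕ p) → sum (map (λ n → c * f n) ns) ≡ c * sum (map f ns)
sum-map-*ˡ c f []       = sym (*-zeroʳ c)
sum-map-*ˡ c f (n ∷ ns) = trans (cong (c * f n +_) (sum-map-*ˡ c f ns)) (sym (*-distribˡ-+ c (f n) _))

[a∸b]*c+[1+c]*b≡c*a+b : ∀ a b c → b ≤ a → (a ∸ b) * c + suc c * b ≡ c * a + b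
[a∸b]*c+[1+c]*b≡c*a+b a b c b≤a = begin
  (a ∸ b) * c + (b + c * b) ≡⟨ cong ((a ∸ b) * c +_) (+-comm b (c * b)) ⟩
  (a ∸ b) * c + (c * b + b) ≡⟨ +-assoc ((a ∸ b) * c) (c * b) b ⟨
  (a ∸ b) * c + c * b + b   ≡⟨ cong (λ x → (a ∸ b) * c + x + b) (*-comm c b) ⟩
  (a ∸ b) * c + b * c + b   ≡⟨ cong (_+ b) (*-distribʳ-+ c (a ∸ b) b) ⟨
  (a ∸ b + b) * c + b       ≡⟨ cong (λ x → x * c + b) (m∸n+n≡m b≤a) ⟩
  a * c + b                 ≡⟨ cong (_+ b) (*-comm a c) ⟩
  c * a + b                 ∎
  where open ≡-Reasoning

corollary3p8 : (p : ℕ) → 2 ≤ p → (ns : Vec ℕ p) → (∀ (i : Fin p) → 1 ≤ lookup ns i)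
  → (m : ℕ) → 2 ≤ m
  → IsSW (CompleteMultipartite ns) m
      (((sum ns C m) ∸ sum (map (λ nᵢ → nᵢ C m) ns)) * (m ∸ 1) + sum (map (λ nᵢ → m * (nᵢ C m)) ns))
    × IsSW (CompleteMultipartite ns) m ((m ∸ 1) * (sum ns C m) + sum (map (λ nᵢ → nᵢ C m) ns))
    × IsWiener (CompleteMultipartite ns) ((sum ns C 2) + sum (map (λ nᵢ → nᵢ C 2) ns))
corollary3p8 _ (s≤s (s≤s _)) ns parts-nonempty m 2≤m@(s≤s {n = m′} _) =
  subst (IsSW X m) (sym rearranged) (isSW-completeMultipartite ns parts-nonempty m 2≤m) ,
  isSW-completeMultipartite ns parts-nonempty m 2≤m ,
  subst (IsSW X 2) (cong (_+ sum (map (_C 2) ns)) (*-identityˡ (N C 2)))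
    (isSW-completeMultipartite ns parts-nonempty 2 ≤-refl)
  where
  X = CompleteMultipartite ns
  N = sum ns
  rearranged : (N C m ∸ sum (map (_C m) ns)) * m′ + sum (map (λ nᵢ → m * (nᵢ C m)) ns)
             ≡ m′ * (N C m) + sum (map (_C m) ns)
  rearranged = trans (cong ((N C m ∸ sum (map (_C m) ns)) * m′ +_) (sum-map-*ˡ m (_C m) ns))
                     ([a∸b]*c+[1+c]*b≡c*a+b _ _ m′ (sum-C≤C-sum ns m′))
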